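{- Let $t\ge1$, let $G$ be a group of order $4t+2$, and let $\psi\in Z^2(G,\langle-1\rangle)$. Then $\psi$ is quasi-orthogonal if and only if $\{(1,g):g\in G\}$ is a relative $(4t+2,2,4t+2,2t+1)$-quasi-difference set in $E_\psi$ with forbidden subgroup $\langle(-1,1)\rangle$.
   Context: A (normalized) cocycle is a map $\psi:G\times G\to\{\pm1\}$ with $\psi(g,h)\psi(gh,k)=\psi(g,hk)\psi(h,k)$ for all $g,h,k$ and $\psi(1,1)=1$; $Z^2(G,\langle-1\rangle)$ is the set of these. For an ordering $g_1=1,\dots,g_{4t+2}$ of $G$, $M_\psi=[\psi(g_i,g_j)]_{i,j}$; for an $n\times n$ $(\pm1)$-matrix $M$ with first row all $1$s, $RE(M)=\sum_{i=2}^n|\sum_j m_{i,j}|$; $\psi$ is quasi-orthogonal if $RE(M_\psi)=4t$. $E_\psi$ is the group with elements $\{(u,g):u\in\{\pm1\},g\in G\}$ and multiplication $(u,g)(v,h)=(uv\,\psi(g,h),gh)$. For a group $E$ of order $8t+4$ and a normal subgroup $Z$ of order $2$, a relative $(4t+2,2,4t+2,2t+1)$-quasi-difference set in $E$ with forbidden subgroup $Z$ is a transversal $R$ for $Z$ in $E$ containing a subset $S\subset R\setminus\{1\}$ with $|S|=2t+1$ such that for all $x\in E\setminus Z$: $|R\cap xR|=2t+1$ if $x\in sZ$ for some $s\in S$, and $|R\cap xR|\in\{2t,2t+2\}$ otherwise. -}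

module Defs where

open import Data.Nat using (ℕ; zero; suc; _+_; _*_)
open import Data.Bool using (Bool; true; false; _∧_; if_then_else_)
open import Data.Fin using (Fin)
import Data.Fin as F
open import Data.List using (List; []; _∷_; length; filterᵇ; allFin; map; _++_)
open import Data.Bool.ListAction using (any)
open import Data.Integer using (ℤ; _◃_; ∣_∣; 0ℤ)
import Data.Integer as ℤ
open import Data.Sign using (Sign)
import Data.Sign as S
import Data.Sign.Properties as SP
open import Data.Product using (Σ; _×_; _,_; proj₁; proj₂)
open import Data.Product.Properties using (≡-dec)
open import Data.Sum using (_⊎_)
open import Relation.Nullary using (¬_; does)
open import Relation.Binary.PropositionalEquality using (_≡_; _≢_)
open import Relation.Binary.Definitions using (DecidableEquality)
open import Algebra.Structures using (IsGroup)

record FinGroup (n : ℕ) : Set where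
  field
    _·_     : Fin n → Fin n → Fin n
    e       : Fin n
    inv     : Fin n → Fin n
    isGroup : IsGroup _≡_ _·_ e inv

-- Normalised 2-cocycles with values in ⟨-1⟩ = {+,-} (Data.Sign, with
-- multiplication S._*_ ; + is 1 and - is -1).

record IsCocycle {n : ℕ} (G : FinGroup n) (ψ : Fin n → Fin n → Sign) : Set where
  open FinGroup G
  field
    cocycle    : ∀ g h k → ψ g h S.* ψ (g · h) k ≡ ψ g (h · k) S.* ψ h k
    normalised : ψ e e ≡ Sign.+

sumℤ : ∀ {n} → (Fin n → ℤ) → ℤ
sumℤ {zero}  f = 0ℤ
sumℤ {suc n} f = f F.zero ℤ.+ sumℤ (λ i → f (F.suc i))

sumℕ : ∀ {n} → (Fin n → ℕ) → ℕ
sumℕ {zero}  f = 0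
sumℕ {suc n} f = f F.zero + sumℕ (λ i → f (F.suc i))

sgn : Sign → ℤ
sgn s = s ◃ 1

-- The matrix M_ψ = [ψ(g_i,g_j)], rows/columns indexed by the group
-- elements; row "1" is the row indexed by the identity e.
-- RE(M_ψ) = Σ_{rows g ≠ 1} | Σ_h ψ(g,h) |.
RE : ∀ {n} (G : FinGroup n) → (Fin n → Fin n → Sign) → ℕ
RE {n} G ψ = sumℕ (λ g → if does (g F.≟ FinGroup.e G) then 0
                           else ∣ sumℤ (λ h → sgn (ψ g h)) ∣)

QuasiOrthogonal : ∀ (t : ℕ) (G : FinGroup (4 * t + 2)) →
                  (Fin (4 * t + 2) → Fin (4 * t + 2) → Sign) → Set
QuasiOrthogonal t G ψ = RE G ψ ≡ 4 * t

-- Finite groups given by a carrier with decidable equality, a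
-- multiplication, an identity, and a list enumerating every element
-- exactly once.  (Used for E_ψ.)  Subsets are Bool-valued predicates.

record FiniteMagma : Set₁ where
  field
    Carrier : Set
    _∙_     : Carrier → Carrier → Carrier
    ε       : Carrier
    _≟_     : DecidableEquality Carrier
    elems   : List Carrier

module _ (E : FiniteMagma) where
  open FiniteMagma E

  #_ : (Carrier → Bool) → ℕ
  # p = length (filterᵇ p elems)

  inCoset : Carrier → (Carrier → Bool) → Carrier → Bool
  inCoset x A y = any (λ a → A a ∧ does ((x ∙ a) ≟ y)) elems

  interTrans : (Carrier → Bool) → Carrier → ℕ
  interTrans A x = # (λ y → A y ∧ inCoset x A y)

  IsNormalSubgroupOfOrder2 : (Carrier → Bool) → Set
  IsNormalSubgroupOfOrder2 Z =
      (# Z ≡ 2)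
    × (Z ε ≡ true)
    × (∀ a b → Z a ≡ true → Z b ≡ true → Z (a ∙ b) ≡ true)
    × (∀ g z → Z z ≡ true → Σ Carrier λ z' → (Z z' ≡ true) × (g ∙ z ≡ z' ∙ g))

  IsTransversal : (Carrier → Bool) → (Carrier → Bool) → Set
  IsTransversal Z R = ∀ x → # (λ y → R y ∧ inCoset x Z y) ≡ 1

  IsRelQDS : ℕ → (Z R : Carrier → Bool) → Set
  IsRelQDS t Z R =
      (length elems ≡ 8 * t + 4)
    × IsNormalSubgroupOfOrder2 Z
    × IsTransversal Z R
    × Σ (Carrier → Bool) λ S →
          (∀ s → S s ≡ true → (R s ≡ true) × (s ≢ ε))
        × (# S ≡ 2 * t + 1)
        × (∀ x → Z x ≡ false →
             ((Σ Carrier λ s → (S s ≡ true) × (inCoset s Z x ≡ true))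
                 → interTrans R x ≡ 2 * t + 1)
           × (¬ (Σ Carrier λ s → (S s ≡ true) × (inCoset s Z x ≡ true))
                 → (interTrans R x ≡ 2 * t) ⊎ (interTrans R x ≡ 2 * t + 2)))

E-elems : (n : ℕ) → List (Sign × Fin n)
E-elems n = map (λ g → (Sign.+ , g)) (allFin n) ++ map (λ g → (Sign.- , g)) (allFin n)

module _ {n : ℕ} (G : FinGroup n) (ψ : Fin n → Fin n → Sign) where
  open FinGroup G

  E : FiniteMagma
  E = record
    { Carrier = Sign × Fin n
    ; _∙_     = λ { (u , g) (v , h) → ((u S.* v) S.* ψ g h , g · h) }
    ; ε       = (Sign.+ , e)
    ; _≟_     = ≡-dec SP._≟_ F._≟_
    ; elems   = E-elems n
    }

  Zψ : Sign × Fin n → Bool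
  Zψ (_ , g) = does (g F.≟ e)

  Rψ : Sign × Fin n → Bool
  Rψ (u , _) = does (u SP.≟ Sign.+)

module Submission where

-- Let n = 4t+2, write neg(g) for the number of entries -1 in row g of M_ψ
-- and call a row g ≠ 1 balanced when neg(g) = 2t+1.  Both sides of the
-- equivalence are reformulations of one "row profile":
--
--   (P1) every row g ≠ 1 is balanced or has neg(g) ∈ {2t, 2t+2};
--   (P2) exactly 2t+1 rows g ≠ 1 are balanced.
--
-- The row sum of row g is n - 2 neg(g), so
-- RE(M_ψ) = 2 Σ_{g≠1} |2t+1 - neg(g)|, and every unbalanced row g ≠ 1
-- contributes at least 2.  The product of the entries of a row is a
-- homomorphism G → {±1} (this uses the cocycle identity and that n is
-- even), and a balanced row has product -1, so at most n/2 = 2t+1 rows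
-- are balanced.  Hence RE = 4t squeezes all the inequalities into (P1),(P2).
--
-- In E_ψ, |R ∩ (u,k)R| counts the h with
-- u ψ(k,h) = 1, i.e. it is neg(k) or n - neg(k); the forbidden subgroup
-- {(±1,1)} is normal and R is a transversal for it.  With
-- S = {(1,g) : g ≠ 1 balanced} the difference-set conditions are (P1),(P2).

open import Defs
open import Data.Nat using (ℕ; zero; suc; _*_; _+_; _≥_; _≤_; z≤n; s≤s; ∣_-_∣)
import Data.Nat.Properties as ℕP
open import Data.Nat.Tactic.RingSolver using (solve-∀)
open import Data.Integer using (+_; _⊖_)
import Data.Integer as ℤ
import Data.Integer.Properties as ℤP
import Data.Integer.Tactic.RingSolver as ℤSolver
open import Data.Fin using (Fin)
import Data.Fin as F
import Data.Fin.Properties as FP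
open import Data.Fin.Permutation using (permutation)
open import Data.Bool using (Bool; true; false; _∧_; not; if_then_else_)
open import Data.Bool.Properties using (⇔→≡; T-≡)
open import Data.Bool.ListAction using (any)
open import Data.Sign using (Sign)
import Data.Sign as S
import Data.Sign.Properties as SP
open import Data.Product using (Σ; _×_; _,_; proj₁; proj₂)
open import Data.Sum using (_⊎_; inj₁; inj₂)
open import Data.Empty using (⊥-elim)
open import Data.List using (length; filterᵇ; tabulate; map; allFin; _++_)
import Data.List.Properties as LP
open import Data.List.Membership.Propositional using (_∈_; find; lose)
open import Data.List.Membership.Propositional.Properties using (∈-map⁺; ∈-++⁺ˡ; ∈-++⁺ʳ; ∈-allFin)
open import Data.List.Relation.Unary.Any.Properties using (any⁺; any⁻)
open import Function using (_∘_; id; Equivalence)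
open import Function.Bundles using (_⇔_; mk⇔)
open import Relation.Nullary using (¬_; Dec; yes; no; does)
open import Relation.Nullary.Decidable using (T?; dec-true; dec-false; does-⇔)
open import Relation.Binary.PropositionalEquality
open import Algebra.Structures using (IsGroup)
import Algebra.Properties.CommutativeMonoid.Sum as CommutativeMonoidSum
import Algebra.Properties.Semiring.Sum as SemiringSum
import Algebra.Properties.Monoid.Mult as MonoidMult

does-true⇒ : ∀ {P : Set} (d : Dec P) → does d ≡ true → P
does-true⇒ (yes p) _ = p
does-true⇒ (no _) ()

does-false⇒ : ∀ {P : Set} (d : Dec P) → does d ≡ false → ¬ P
does-false⇒ (yes _) ()
does-false⇒ (no ¬p) _ = ¬p

∧-true : ∀ {a b} → a ∧ b ≡ true → (a ≡ true) × (b ≡ true)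
∧-true {true} b≡true = refl , b≡true

bool-ext : ∀ {a b} → (a ≡ true → b ≡ true) → (b ≡ true → a ≡ true) → a ≡ b
bool-ext to from = ⇔→≡ (mk⇔ to from)

any-witness : ∀ {A : Set} (p : A → Bool) xs → any p xs ≡ true → Σ A λ a → p a ≡ true
any-witness p xs holds with find (any⁻ p xs (Equivalence.from T-≡ holds))
... | a , _ , pa = a , Equivalence.to T-≡ pa

any-member : ∀ {A : Set} (p : A → Bool) {xs x} → x ∈ xs → p x ≡ true → any p xs ≡ true
any-member p x∈xs px = Equivalence.to T-≡ (any⁺ p (lose x∈xs (Equivalence.from T-≡ px)))

module ℕΣ = CommutativeMonoidSum ℕP.+-0-commutativeMonoid

sumℕ≡Σ : ∀ {n} (f : Fin n → ℕ) → sumℕ f ≡ ℕΣ.sum f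
sumℕ≡Σ {zero} f = refl
sumℕ≡Σ {suc n} f = cong (λ rest → f F.zero + rest) (sumℕ≡Σ (f ∘ F.suc))

sumℕ-reindex : ∀ {n} (f : Fin n → ℕ) (π σ : Fin n → Fin n) →
  (∀ i → π (σ i) ≡ i) → (∀ i → σ (π i) ≡ i) → sumℕ (f ∘ π) ≡ sumℕ f
sumℕ-reindex f π σ πσ σπ = begin
  sumℕ (f ∘ π)    ≡⟨ sumℕ≡Σ (f ∘ π) ⟩
  ℕΣ.sum (f ∘ π)  ≡⟨ ℕΣ.sum-permute f (permutation π σ πσ σπ) ⟨
  ℕΣ.sum f        ≡⟨ sumℕ≡Σ f ⟨
  sumℕ f          ∎
  where open ≡-Reasoning

sumℕ-cong : ∀ {n} {f g : Fin n → ℕ} → (∀ i → f i ≡ g i) → sumℕ f ≡ sumℕ g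
sumℕ-cong {f = f} {g} f≗g =
  trans (sumℕ≡Σ f) (trans (ℕΣ.sum-cong-≗ f≗g) (sym (sumℕ≡Σ g)))

sumℕ-+ : ∀ {n} (f g : Fin n → ℕ) → sumℕ (λ i → f i + g i) ≡ sumℕ f + sumℕ g
sumℕ-+ f g = trans (sumℕ≡Σ (λ i → f i + g i))
  (trans (ℕΣ.∑-distrib-+ f g) (sym (cong₂ _+_ (sumℕ≡Σ f) (sumℕ≡Σ g))))

sumℕ-*ˡ : ∀ {n} k (f : Fin n → ℕ) → sumℕ (λ i → k * f i) ≡ k * sumℕ f
sumℕ-*ˡ k f = trans (sumℕ≡Σ (λ i → k * f i))
  (trans (sym (SemiringSum.*-distribˡ-sum ℕP.+-*-semiring k f)) (cong (k *_) (sym (sumℕ≡Σ f))))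

sumℕ-mono : ∀ {n} {f g : Fin n → ℕ} → (∀ i → f i ≤ g i) → sumℕ f ≤ sumℕ g
sumℕ-mono {zero} f≤g = z≤n
sumℕ-mono {suc n} f≤g = ℕP.+-mono-≤ (f≤g F.zero) (sumℕ-mono (f≤g ∘ F.suc))

sumℕ-squeeze : ∀ {n} {f g : Fin n → ℕ} → (∀ i → f i ≤ g i) → sumℕ f ≡ sumℕ g →
  ∀ i → f i ≡ g i
sumℕ-squeeze {suc n} {f} {g} f≤g same i = pointwise i
  where
    tails : sumℕ (f ∘ F.suc) ≤ sumℕ (g ∘ F.suc)
    tails = sumℕ-mono (f≤g ∘ F.suc)

    heads : f F.zero ≡ g F.zero
    heads = ℕP.≤-antisym (f≤g F.zero) (ℕP.+-cancelʳ-≤ _ _ _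
      (ℕP.≤-trans (ℕP.+-monoʳ-≤ (g F.zero) tails) (ℕP.≤-reflexive (sym same))))

    pointwise : ∀ i → f i ≡ g i
    pointwise F.zero = heads
    pointwise (F.suc i) = sumℕ-squeeze (f≤g ∘ F.suc)
      (ℕP.+-cancelˡ-≡ (f F.zero) _ _ (trans same (cong (λ x → x + sumℕ (g ∘ F.suc)) (sym heads)))) i

ind : Bool → ℕ
ind true = 1
ind false = 0

count : ∀ {n} → (Fin n → Bool) → ℕ
count p = sumℕ (ind ∘ p)

count-cong : ∀ {n} {p q : Fin n → Bool} → (∀ i → p i ≡ q i) → count p ≡ count q
count-cong p≗q = sumℕ-cong (cong ind ∘ p≗q)

count-none : ∀ {n} → count {n} (λ _ → false) ≡ 0
count-none {zero} = refl
count-none {suc n} = count-none {n}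

count-mono : ∀ {n} {p q : Fin n → Bool} → (∀ i → p i ≡ true → q i ≡ true) → count p ≤ count q
count-mono p⇒q = sumℕ-mono (λ i → ind-mono (p⇒q i))
  where
    ind-mono : ∀ {a b} → (a ≡ true → b ≡ true) → ind a ≤ ind b
    ind-mono {false} _ = z≤n
    ind-mono {true} a⇒b rewrite a⇒b refl = ℕP.≤-refl

count-complement : ∀ {n} (p : Fin n → Bool) → count p + count (not ∘ p) ≡ n
count-complement {n} p = begin
  count p + count (not ∘ p)   ≡⟨ sumℕ-+ (ind ∘ p) (ind ∘ not ∘ p) ⟨
  sumℕ (λ i → ind (p i) + ind (not (p i))) ≡⟨ sumℕ-cong (λ i → one (p i)) ⟩
  sumℕ {n} (λ _ → 1)           ≡⟨ all-ones n ⟩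
  n                           ∎
  where
    open ≡-Reasoning
    one : ∀ b → ind b + ind (not b) ≡ 1
    one true = refl
    one false = refl
    all-ones : ∀ n → sumℕ {n} (λ _ → 1) ≡ n
    all-ones zero = refl
    all-ones (suc n) = cong suc (all-ones n)

count-singleton : ∀ {n} (a : Fin n) → count (λ i → does (i F.≟ a)) ≡ 1
count-singleton {suc n} F.zero = cong suc (count-none {n})
count-singleton {suc n} (F.suc a) =
  trans (count-cong (λ i → does-suc i)) (count-singleton a)
  where
    does-suc : ∀ i → does (F.suc i F.≟ F.suc a) ≡ does (i F.≟ a)
    does-suc i = does-⇔ (mk⇔ FP.suc-injective (cong F.suc)) (F.suc i F.≟ F.suc a) (i F.≟ a)

length-filter-tabulate : ∀ {A : Set} {n} (p : A → Bool) (f : Fin n → A) →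
  length (filterᵇ p (tabulate f)) ≡ count (p ∘ f)
length-filter-tabulate {n = zero} p f = refl
length-filter-tabulate {n = suc n} p f with p (f F.zero)
... | true = cong suc (length-filter-tabulate p (f ∘ F.suc))
... | false = length-filter-tabulate p (f ∘ F.suc)

isPositive : Sign → Bool
isPositive s = does (s SP.≟ Sign.+)

isNegative : Sign → Bool
isNegative s = not (isPositive s)

isPositive-flip : ∀ s → isPositive (Sign.- S.* s) ≡ isNegative s
isPositive-flip Sign.+ = refl
isPositive-flip Sign.- = refl

sum-of-signs : ∀ {m} (f : Fin m → Sign) → let k = count (isNegative ∘ f) in
  sumℤ (sgn ∘ f) ℤ.+ (+ k ℤ.+ + k) ≡ + m
sum-of-signs {zero} f = refl
sum-of-signs {suc m} f with f F.zero
... | Sign.+ = trans (plus-step (sumℤ (sgn ∘ f ∘ F.suc)) (+ count (isNegative ∘ f ∘ F.suc)))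
                   (cong (λ rest → ℤ.1ℤ ℤ.+ rest) (sum-of-signs (f ∘ F.suc)))
  where
    plus-step : ∀ s k → ℤ.1ℤ ℤ.+ s ℤ.+ (k ℤ.+ k) ≡ ℤ.1ℤ ℤ.+ (s ℤ.+ (k ℤ.+ k))
    plus-step = ℤSolver.solve-∀
... | Sign.- = trans (minus-step (sumℤ (sgn ∘ f ∘ F.suc)) (+ count (isNegative ∘ f ∘ F.suc)))
                   (cong (λ rest → ℤ.1ℤ ℤ.+ rest) (sum-of-signs (f ∘ F.suc)))
  where
    minus-step : ∀ s k →
      ℤ.-1ℤ ℤ.+ s ℤ.+ ((ℤ.1ℤ ℤ.+ k) ℤ.+ (ℤ.1ℤ ℤ.+ k)) ≡ ℤ.1ℤ ℤ.+ (s ℤ.+ (k ℤ.+ k))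
    minus-step = ℤSolver.solve-∀

∣⊖∣≡∣-∣ : ∀ a b → ℤ.∣ a ⊖ b ∣ ≡ ∣ a - b ∣
∣⊖∣≡∣-∣ a b with ℕP.≤-total b a
... | inj₁ b≤a = trans (ℤP.∣m⊖n∣≡∣n⊖m∣ a b) (trans (ℤP.∣⊖∣-≤ b≤a)
                   (sym (trans (ℕP.∣-∣-comm a b) (ℕP.m≤n⇒∣m-n∣≡n∸m b≤a))))
... | inj₂ a≤b = trans (ℤP.∣⊖∣-≤ a≤b) (sym (ℕP.m≤n⇒∣m-n∣≡n∸m a≤b))

∣sum-of-signs∣ : ∀ {m} (f : Fin m → Sign) → let k = count (isNegative ∘ f) in
  ℤ.∣ sumℤ (sgn ∘ f) ∣ ≡ ∣ m - (k + k) ∣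
∣sum-of-signs∣ {m} f = trans (cong ℤ.∣_∣ sum≡) (∣⊖∣≡∣-∣ m (k + k))
  where
    k : ℕ
    k = count (isNegative ∘ f)
    s : ℤ.ℤ
    s = sumℤ (sgn ∘ f)
    cancel : ∀ s K → s ≡ (s ℤ.+ K) ℤ.- K
    cancel = ℤSolver.solve-∀
    sum≡ : s ≡ m ⊖ (k + k)
    sum≡ = begin
      s                              ≡⟨ cancel s (+ k ℤ.+ + k) ⟩
      (s ℤ.+ (+ k ℤ.+ + k)) ℤ.- + (k + k) ≡⟨ cong (ℤ._- + (k + k)) (sum-of-signs f) ⟩
      + m ℤ.- + (k + k)               ≡⟨ ℤP.m-n≡m⊖n m (k + k) ⟩
      m ⊖ (k + k)                     ∎
      where open ≡-Reasoning

module SignΠ = CommutativeMonoidSum SP.*-commutativeMonoid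
module SignPower = MonoidMult SP.*-monoid
open SignΠ using () renaming (sum to prodS)

minusOne^ : ℕ → Sign
minusOne^ k = k SignPower.× Sign.-

prodS-negatives : ∀ {m} (f : Fin m → Sign) → prodS f ≡ minusOne^ (count (isNegative ∘ f))
prodS-negatives {zero} f = refl
prodS-negatives {suc m} f with f F.zero
... | Sign.+ = prodS-negatives (f ∘ F.suc)
... | Sign.- = cong (Sign.- S.*_) (prodS-negatives (f ∘ F.suc))

even-power : ∀ a s → (a + a) SignPower.× s ≡ Sign.+
even-power a s = trans (SignPower.×-homo-+ s a a) (SP.s*s≡+ (a SignPower.× s))

minusOne^-odd : ∀ a → minusOne^ (a + a + 1) ≡ Sign.-
minusOne^-odd a = trans (SignPower.×-homo-+ Sign.- (a + a) 1) (cong (S._* Sign.-) (even-power a Sign.-))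

prodS-constant : ∀ {m} a s → m ≡ a + a → prodS {m} (λ _ → s) ≡ Sign.+
prodS-constant a s refl = trans (SignΠ.sum-replicate (a + a)) (even-power a s)

module FiniteGroup {m : ℕ} (G : FinGroup m) where
  open FinGroup G
  open IsGroup isGroup using (assoc; identityˡ; inverseˡ; inverseʳ)

  cancelˡ : ∀ k h → inv k · (k · h) ≡ h
  cancelˡ k h = trans (sym (assoc (inv k) k h)) (trans (cong (_· h) (inverseˡ k)) (identityˡ h))

  cancelʳ : ∀ k h → k · (inv k · h) ≡ h
  cancelʳ k h = trans (sym (assoc k (inv k) h)) (trans (cong (_· h) (inverseʳ k)) (identityˡ h))

  prodS-translate : ∀ a (f : Fin m → Sign) → prodS (λ g → f (a · g)) ≡ prodS f
  prodS-translate a f = sym (SignΠ.sum-permute f (permutation (a ·_) (inv a ·_) (cancelʳ a) (cancelˡ a)))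

  count-translate : ∀ a (p : Fin m → Bool) → count (λ g → p (a · g)) ≡ count p
  count-translate a p = sumℕ-reindex (ind ∘ p) (a ·_) (inv a ·_) (cancelʳ a) (cancelˡ a)

  -- A homomorphism χ : G → {±1} takes the value -1 on at most half of G:
  -- if χ(a) = -1 then translation by a swaps χ⁻¹(-1) and χ⁻¹(+1).
  character-negatives : (χ : Fin m → Sign) → (∀ g h → χ (g · h) ≡ χ g S.* χ h) →
    2 * count (isNegative ∘ χ) ≤ m
  character-negatives χ χ-hom with FP.any? (λ a → χ a SP.≟ Sign.-)
  ... | no none = subst (_≤ m) (sym (cong (2 *_) none-negative)) z≤n
    where
      no-negatives : ∀ g → isNegative (χ g) ≡ false
      no-negatives g with χ g in χg
      ... | Sign.+ = refl
      ... | Sign.- = ⊥-elim (none (g , χg))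
      none-negative : count (isNegative ∘ χ) ≡ 0
      none-negative = trans (count-cong no-negatives) (count-none {m})
  ... | yes (a , χa) = ℕP.≤-reflexive (begin
      2 * c                             ≡⟨ cong (λ x → c + x) (ℕP.+-identityʳ c) ⟩
      c + c                             ≡⟨ cong (λ x → c + x) swapped ⟩
      c + count (not ∘ isNegative ∘ χ)  ≡⟨ count-complement (isNegative ∘ χ) ⟩
      m                                 ∎)
    where
      open ≡-Reasoning
      c : ℕ
      c = count (isNegative ∘ χ)
      flip : ∀ g → isNegative (χ (a · g)) ≡ not (isNegative (χ g))
      flip g rewrite χ-hom a g | χa with χ g
      ... | Sign.+ = refl
      ... | Sign.- = refl
      swapped : c ≡ count (not ∘ isNegative ∘ χ)
      swapped = trans (sym (count-translate a (isNegative ∘ χ))) (count-cong flip)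

-- Normalised cocycles

module Cocycle {m : ℕ} (G : FinGroup m) (ψ : Fin m → Fin m → Sign) (coc : IsCocycle G ψ) where
  open FinGroup G
  open IsGroup isGroup using (identityˡ; identityʳ)
  open IsCocycle coc
  open FiniteGroup G

  ψ-identityˡ : ∀ h → ψ e h ≡ Sign.+
  ψ-identityˡ h = begin
    ψ e h                      ≡⟨ cong₂ (λ s x → s S.* ψ x h) normalised (identityˡ e) ⟨
    ψ e e S.* ψ (e · e) h      ≡⟨ cocycle e e h ⟩
    ψ e (e · h) S.* ψ e h      ≡⟨ cong (λ x → ψ e x S.* ψ e h) (identityˡ h) ⟩
    ψ e h S.* ψ e h            ≡⟨ SP.s*s≡+ (ψ e h) ⟩
    Sign.+                     ∎
    where open ≡-Reasoning

  ψ-identityʳ : ∀ g → ψ g e ≡ Sign.+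
  ψ-identityʳ g = begin
    ψ g e                      ≡⟨ SP.*-identityʳ (ψ g e) ⟨
    ψ g e S.* Sign.+           ≡⟨ cong₂ (λ x y → ψ g x S.* y) (identityˡ e) normalised ⟨
    ψ g (e · e) S.* ψ e e      ≡⟨ cocycle g e e ⟨
    ψ g e S.* ψ (g · e) e      ≡⟨ cong (λ x → ψ g e S.* ψ x e) (identityʳ g) ⟩
    ψ g e S.* ψ g e            ≡⟨ SP.s*s≡+ (ψ g e) ⟩
    Sign.+                     ∎
    where open ≡-Reasoning

  -- On a group of even order, the product of the entries of a row is a
  -- homomorphism: take the product over k of the cocycle identity
  -- ψ(g,h) ψ(gh,k) = ψ(g,hk) ψ(h,k) and reindex k ↦ hk.
  rowProduct : Fin m → Sign
  rowProduct g = prodS (ψ g)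

  rowProduct-hom : ∀ {a} → m ≡ a + a → ∀ g h → rowProduct (g · h) ≡ rowProduct g S.* rowProduct h
  rowProduct-hom {a} even g h = begin
    rowProduct (g · h)
      ≡⟨ cong (S._* rowProduct (g · h)) (prodS-constant a (ψ g h) even) ⟨
    prodS {m} (λ _ → ψ g h) S.* prodS (ψ (g · h))
      ≡⟨ SignΠ.∑-distrib-+ (λ _ → ψ g h) (ψ (g · h)) ⟨
    prodS (λ k → ψ g h S.* ψ (g · h) k)
      ≡⟨ SignΠ.sum-cong-≗ (cocycle g h) ⟩
    prodS (λ k → ψ g (h · k) S.* ψ h k)
      ≡⟨ SignΠ.∑-distrib-+ (λ k → ψ g (h · k)) (ψ h) ⟩
    prodS (λ k → ψ g (h · k)) S.* rowProduct h
      ≡⟨ cong (S._* rowProduct h) (prodS-translate h (ψ g)) ⟩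
    rowProduct g S.* rowProduct h
      ∎
    where open ≡-Reasoning

-- In {±1} every element is its own inverse, so (u w) p = v has the unique
-- solution w = (u v) p.
sign-unmultiply : ∀ u w p → (u S.* ((u S.* w) S.* p)) S.* p ≡ w
sign-unmultiply Sign.+ Sign.+ Sign.+ = refl
sign-unmultiply Sign.+ Sign.+ Sign.- = refl
sign-unmultiply Sign.+ Sign.- Sign.+ = refl
sign-unmultiply Sign.+ Sign.- Sign.- = refl
sign-unmultiply Sign.- Sign.+ Sign.+ = refl
sign-unmultiply Sign.- Sign.+ Sign.- = refl
sign-unmultiply Sign.- Sign.- Sign.+ = refl
sign-unmultiply Sign.- Sign.- Sign.- = refl

inCoset-solution : (M : FiniteMagma) → let open FiniteMagma M in
  (∀ y → y ∈ elems) → ∀ x y q → x ∙ q ≡ y → (∀ a → x ∙ a ≡ y → a ≡ q) →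
  ∀ A → inCoset M x A y ≡ A q
inCoset-solution M complete x y q solves unique A = bool-ext to from
  where
    open FiniteMagma M
    to : inCoset M x A y ≡ true → A q ≡ true
    to y∈xA with any-witness (λ a → A a ∧ does ((x ∙ a) ≟ y)) elems y∈xA
    ... | a , hit with ∧-true hit
    ... | Aa , xa≡y = subst (λ b → A b ≡ true) (unique a (does-true⇒ ((x ∙ a) ≟ y) xa≡y)) Aa
    from : A q ≡ true → inCoset M x A y ≡ true
    from Aq = any-member (λ a → A a ∧ does ((x ∙ a) ≟ y)) (complete q)
      (cong₂ _∧_ Aq (dec-true ((x ∙ q) ≟ y) solves))

-- The extension group E_ψ

count-E : ∀ n (p : Sign × Fin n → Bool) →
  length (filterᵇ p (E-elems n)) ≡ count (λ g → p (Sign.+ , g)) + count (λ g → p (Sign.- , g))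
count-E n p = begin
  length (filterᵇ p (map plus (allFin n) ++ map minus (allFin n)))
    ≡⟨ cong length (LP.filter-++ (T? ∘ p) (map plus (allFin n)) (map minus (allFin n))) ⟩
  length (filterᵇ p (map plus (allFin n)) ++ filterᵇ p (map minus (allFin n)))
    ≡⟨ LP.length-++ (filterᵇ p (map plus (allFin n))) ⟩
  length (filterᵇ p (map plus (allFin n))) + length (filterᵇ p (map minus (allFin n)))
    ≡⟨ cong₂ _+_ (sheet plus) (sheet minus) ⟩
  count (p ∘ plus) + count (p ∘ minus)
    ∎
  where
    open ≡-Reasoning
    plus minus : Fin n → Sign × Fin n
    plus g = (Sign.+ , g)
    minus g = (Sign.- , g)
    sheet : (f : Fin n → Sign × Fin n) → length (filterᵇ p (map f (allFin n))) ≡ count (p ∘ f)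
    sheet f = trans (cong (length ∘ filterᵇ p) (LP.map-tabulate id f)) (length-filter-tabulate p f)

length-E : ∀ n → length (E-elems n) ≡ n + n
length-E n = trans (LP.length-++ (map plus (allFin n))) (cong₂ _+_ (sheet plus) (sheet minus))
  where
    plus minus : Fin n → Sign × Fin n
    plus g = (Sign.+ , g)
    minus g = (Sign.- , g)
    sheet : (f : Fin n → Sign × Fin n) → length (map f (allFin n)) ≡ n
    sheet f = trans (LP.length-map f (allFin n)) (LP.length-tabulate id)

E-complete : ∀ n (y : Sign × Fin n) → y ∈ E-elems n
E-complete n (Sign.+ , g) = ∈-++⁺ˡ (∈-map⁺ (λ g → (Sign.+ , g)) (∈-allFin g))
E-complete n (Sign.- , g) =
  ∈-++⁺ʳ (map (λ g → (Sign.+ , g)) (allFin n)) (∈-map⁺ (λ g → (Sign.- , g)) (∈-allFin g))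

module Extension {n : ℕ} (G : FinGroup n) (ψ : Fin n → Fin n → Sign) (coc : IsCocycle G ψ) where
  open FinGroup G
  open IsGroup isGroup using (identityˡ; identityʳ; inverseˡ)
  open FiniteGroup G
  open Cocycle G ψ coc
  open FiniteMagma (E G ψ) using (_∙_)

  Z R : Sign × Fin n → Bool
  Z = Zψ G ψ
  R = Rψ G ψ

  -- Left division in E_ψ: (u,k) ∙ ((u,k) ⧵ y) = y.
  _⧵_ : Sign × Fin n → Sign × Fin n → Sign × Fin n
  (u , k) ⧵ (v , g) = ((u S.* v) S.* ψ k (inv k · g) , inv k · g)

  inCoset-E : ∀ x y A → inCoset (E G ψ) x A y ≡ A (x ⧵ y)
  inCoset-E (u , k) (v , g) A =
    inCoset-solution (E G ψ) (E-complete n) (u , k) (v , g) ((u , k) ⧵ (v , g)) solves unique A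
    where
      solves : (u , k) ∙ ((u , k) ⧵ (v , g)) ≡ (v , g)
      solves = cong₂ _,_ (sign-unmultiply u v _) (cancelʳ k g)
      unique : ∀ a → (u , k) ∙ a ≡ (v , g) → a ≡ (u , k) ⧵ (v , g)
      unique (w , h) eq = cong₂ _,_ w≡ h≡
        where
          h≡ : h ≡ inv k · g
          h≡ = trans (sym (cancelˡ k h)) (cong (inv k ·_) (cong proj₂ eq))
          w≡ : w ≡ (u S.* v) S.* ψ k (inv k · g)
          w≡ = begin
            w                                    ≡⟨ sign-unmultiply u w (ψ k h) ⟨
            (u S.* ((u S.* w) S.* ψ k h)) S.* ψ k h ≡⟨ cong (λ s → (u S.* s) S.* ψ k h) (cong proj₁ eq) ⟩
            (u S.* v) S.* ψ k h                  ≡⟨ cong (λ x → (u S.* v) S.* ψ k x) h≡ ⟩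
            (u S.* v) S.* ψ k (inv k · g)        ∎
            where open ≡-Reasoning

  inCoset-Z : ∀ x y → inCoset (E G ψ) x Z y ≡ does (proj₂ y F.≟ proj₂ x)
  inCoset-Z (u , k) (v , g) = trans (inCoset-E (u , k) (v , g) Z)
    (does-⇔ (mk⇔ to from) ((inv k · g) F.≟ e) (g F.≟ k))
    where
      to : inv k · g ≡ e → g ≡ k
      to eq = trans (sym (cancelʳ k g)) (trans (cong (k ·_) eq) (identityʳ k))
      from : g ≡ k → inv k · g ≡ e
      from refl = inverseˡ g

  -- Z = {(±1, 1)} is a normal subgroup of order 2: it is central because ψ is normalised.
  Z-normal : IsNormalSubgroupOfOrder2 (E G ψ) Z
  Z-normal = order , dec-true (e F.≟ e) refl , closed , normal
    where
      order : length (filterᵇ Z (E-elems n)) ≡ 2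
      order = trans (count-E n Z) (cong₂ _+_ (count-singleton e) (count-singleton e))
      closed : ∀ a b → Z a ≡ true → Z b ≡ true → Z (a ∙ b) ≡ true
      closed (_ , a) (_ , b) Za Zb = dec-true ((a · b) F.≟ e)
        (trans (cong₂ _·_ (does-true⇒ (a F.≟ e) Za) (does-true⇒ (b F.≟ e) Zb)) (identityˡ e))
      normal : ∀ g z → Z z ≡ true → Σ (Sign × Fin n) λ z′ → (Z z′ ≡ true) × (g ∙ z ≡ z′ ∙ g)
      normal (u , g) (w , k) Zz with does-true⇒ (k F.≟ e) Zz
      ... | refl = (w , e) , Zz , cong₂ _,_ central (trans (identityʳ g) (sym (identityˡ g)))
        where
          central : (u S.* w) S.* ψ g e ≡ (w S.* u) S.* ψ e g
          central = cong₂ S._*_ (SP.*-comm u w) (trans (ψ-identityʳ g) (sym (ψ-identityˡ g)))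

  R-transversal : IsTransversal (E G ψ) Z R
  R-transversal x = trans (count-E n (λ y → R y ∧ inCoset (E G ψ) x Z y))
    (cong₂ _+_ (trans (count-cong (λ g → inCoset-Z x (Sign.+ , g))) (count-singleton (proj₂ x)))
               (count-none {n}))

  interTrans-R : ∀ u k → interTrans (E G ψ) R (u , k) ≡ count (λ h → isPositive (u S.* ψ k h))
  interTrans-R u k = begin
    interTrans (E G ψ) R (u , k)
      ≡⟨ count-E n (λ y → R y ∧ inCoset (E G ψ) (u , k) R y) ⟩
    count (λ g → inCoset (E G ψ) (u , k) R (Sign.+ , g)) + count {n} (λ _ → false)
      ≡⟨ cong₂ _+_ (count-cong (λ g → inCoset-E (u , k) (Sign.+ , g) R)) (count-none {n}) ⟩
    count (λ g → isPositive ((u S.* Sign.+) S.* ψ k (inv k · g))) + 0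
      ≡⟨ ℕP.+-identityʳ _ ⟩
    count (λ g → isPositive ((u S.* Sign.+) S.* ψ k (inv k · g)))
      ≡⟨ cong (λ s → count (λ g → isPositive (s S.* ψ k (inv k · g)))) (SP.*-identityʳ u) ⟩
    count (λ g → isPositive (u S.* ψ k (inv k · g)))
      ≡⟨ count-translate (inv k) (λ h → isPositive (u S.* ψ k h)) ⟩
    count (λ h → isPositive (u S.* ψ k h))
      ∎
    where open ≡-Reasoning

distance-one : ∀ a k → ∣ a - k ∣ ≡ 1 → suc k ≡ a ⊎ k ≡ suc a
distance-one zero (suc zero) _ = inj₂ refl
distance-one (suc zero) zero _ = inj₁ refl
distance-one (suc a) (suc k) d with distance-one a k d
... | inj₁ below = inj₁ (cong suc below)
... | inj₂ above = inj₂ (cong suc above)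

∣n-suc-n∣≡1 : ∀ k → ∣ k - suc k ∣ ≡ 1
∣n-suc-n∣≡1 zero = refl
∣n-suc-n∣≡1 (suc k) = ∣n-suc-n∣≡1 k

distance-one⁻ : ∀ a k → suc k ≡ a ⊎ k ≡ suc a → ∣ a - k ∣ ≡ 1
distance-one⁻ a k (inj₁ refl) = trans (ℕP.∣-∣-comm (suc k) k) (∣n-suc-n∣≡1 k)
distance-one⁻ a k (inj₂ refl) = ∣n-suc-n∣≡1 a

-- RE(M_ψ)/2 plus the number of
-- balanced rows is the total weight.
rowWeight : Bool → Bool → ℕ → ℕ
rowWeight isId isBal d = (if isId then 0 else d) + ind (not isId ∧ isBal)

rowWeight-≥ : ∀ b c d → (c ≡ false → d ≢ 0) → ind (not b) ≤ rowWeight b c d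
rowWeight-≥ true c d _ = z≤n
rowWeight-≥ false true d _ = ℕP.m≤n+m 1 d
rowWeight-≥ false false zero positive = ⊥-elim (positive refl refl)
rowWeight-≥ false false (suc d) _ = s≤s z≤n

rowWeight-unit : ∀ b c d → (b ≡ false → (c ≡ true × d ≡ 0) ⊎ (c ≡ false × d ≡ 1)) →
  rowWeight b c d ≡ ind (not b)
rowWeight-unit true c d _ = refl
rowWeight-unit false c d shape with shape refl
... | inj₁ (refl , refl) = refl
... | inj₂ (refl , refl) = refl

rowWeight-unbalanced : ∀ {b c d} → b ≡ false → c ≡ false → rowWeight b c d ≡ ind (not b) → d ≡ 1
rowWeight-unbalanced {d = d} refl refl unit = trans (sym (ℕP.+-identityʳ d)) unit

-- The row profile of a cocycle on a group of order 4t+2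

module RowProfile (t : ℕ) (G : FinGroup (4 * t + 2))
                  (ψ : Fin (4 * t + 2) → Fin (4 * t + 2) → Sign) (coc : IsCocycle G ψ) where
  open FinGroup G
  open FiniteGroup G
  open Cocycle G ψ coc
  open Extension G ψ coc

  n : ℕ
  n = 4 * t + 2

  n-halves : n ≡ (2 * t + 1) + (2 * t + 1)
  n-halves = halves t
    where
      halves : ∀ t → 4 * t + 2 ≡ (2 * t + 1) + (2 * t + 1)
      halves = solve-∀

  n-double : n ≡ 2 * (2 * t + 1)
  n-double = double t
    where
      double : ∀ t → 4 * t + 2 ≡ 2 * (2 * t + 1)
      double = solve-∀

  negatives : Fin n → ℕ
  negatives g = count (isNegative ∘ ψ g)

  -- Half the absolute row sum: |Σ_h ψ(g,h)| = 2 · defect g.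
  defect : Fin n → ℕ
  defect g = ∣ (2 * t + 1) - negatives g ∣

  isIdentity nonIdentity isBalanced balanced : Fin n → Bool
  isIdentity g = does (g F.≟ e)
  nonIdentity g = not (isIdentity g)
  isBalanced g = does (negatives g ℕP.≟ 2 * t + 1)
  balanced g = nonIdentity g ∧ isBalanced g

  maskedDefect : Fin n → ℕ
  maskedDefect g = if isIdentity g then 0 else defect g

  OffByOne : ℕ → Set
  OffByOne k = k ≡ 2 * t ⊎ k ≡ 2 * t + 2

  balanced⇒defect-zero : ∀ g → negatives g ≡ 2 * t + 1 → defect g ≡ 0
  balanced⇒defect-zero g bal = ℕP.m≡n⇒∣m-n∣≡0 (sym bal)

  defect-one⇒off-by-one : ∀ g → defect g ≡ 1 → OffByOne (negatives g)
  defect-one⇒off-by-one g d with distance-one (2 * t + 1) (negatives g) d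
  ... | inj₁ below = inj₁ (ℕP.suc-injective (trans below (ℕP.+-comm (2 * t) 1)))
  ... | inj₂ above = inj₂ (trans above (step t))
    where
      step : ∀ t → suc (2 * t + 1) ≡ 2 * t + 2
      step = solve-∀

  off-by-one⇒defect-one : ∀ g → OffByOne (negatives g) → defect g ≡ 1
  off-by-one⇒defect-one g near = distance-one⁻ (2 * t + 1) (negatives g) (shift near)
    where
      shift : OffByOne (negatives g) → suc (negatives g) ≡ 2 * t + 1 ⊎ negatives g ≡ suc (2 * t + 1)
      shift (inj₁ below) = inj₁ (trans (cong suc below) (ℕP.+-comm 1 (2 * t)))
      shift (inj₂ above) = inj₂ (trans above (step t))
        where
          step : ∀ t → 2 * t + 2 ≡ suc (2 * t + 1)
          step = solve-∀

  off-by-one⇒unbalanced : ∀ g → OffByOne (negatives g) → isBalanced g ≡ false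
  off-by-one⇒unbalanced g near = dec-false (negatives g ℕP.≟ 2 * t + 1)
    (λ bal → ℕP.1+n≢0 (trans (sym (off-by-one⇒defect-one g near)) (balanced⇒defect-zero g bal)))

  ∣row-sum∣ : ∀ g → ℤ.∣ sumℤ (sgn ∘ ψ g) ∣ ≡ 2 * defect g
  ∣row-sum∣ g = begin
    ℤ.∣ sumℤ (sgn ∘ ψ g) ∣                  ≡⟨ ∣sum-of-signs∣ (ψ g) ⟩
    ∣ n - (k + k) ∣                          ≡⟨ cong₂ ∣_-_∣ n-double (double k) ⟩
    ∣ 2 * (2 * t + 1) - 2 * k ∣              ≡⟨ ℕP.*-distribˡ-∣-∣ 2 (2 * t + 1) k ⟨
    2 * defect g                             ∎
    where
      open ≡-Reasoning
      k : ℕ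
      k = negatives g
      double : ∀ k → k + k ≡ 2 * k
      double = solve-∀

  RE-defects : RE G ψ ≡ 2 * sumℕ maskedDefect
  RE-defects = trans (sumℕ-cong masked) (sumℕ-*ˡ 2 maskedDefect)
    where
      masked : ∀ g → (if does (g F.≟ e) then 0 else ℤ.∣ sumℤ (sgn ∘ ψ g) ∣)
                     ≡ 2 * (if does (g F.≟ e) then 0 else defect g)
      masked g with does (g F.≟ e)
      ... | true = refl
      ... | false = ∣row-sum∣ g

  nonIdentity-count : count nonIdentity ≡ 4 * t + 1
  nonIdentity-count = ℕP.suc-injective (begin
    suc (count nonIdentity)              ≡⟨ cong (λ c → c + count nonIdentity) (count-singleton e) ⟨
    count isIdentity + count nonIdentity ≡⟨ count-complement isIdentity ⟩
    4 * t + 2                            ≡⟨ step t ⟩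
    suc (4 * t + 1)                      ∎)
    where
      open ≡-Reasoning
      step : ∀ t → 4 * t + 2 ≡ suc (4 * t + 1)
      step = solve-∀

  balanced⇒negatives : ∀ g → balanced g ≡ true → negatives g ≡ 2 * t + 1
  balanced⇒negatives g bal =
    does-true⇒ (negatives g ℕP.≟ 2 * t + 1) (proj₂ (∧-true {nonIdentity g} bal))

  balanced⇒negative : ∀ g → balanced g ≡ true → isNegative (rowProduct g) ≡ true
  balanced⇒negative g bal = cong isNegative (begin
    rowProduct g                         ≡⟨ prodS-negatives (ψ g) ⟩
    minusOne^ (negatives g)              ≡⟨ cong minusOne^ (balanced⇒negatives g bal) ⟩
    minusOne^ (2 * t + 1)                ≡⟨ cong minusOne^ (odd t) ⟩
    minusOne^ (t + t + 1)                ≡⟨ minusOne^-odd t ⟩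
    Sign.-                               ∎)
    where
      open ≡-Reasoning
      odd : ∀ t → 2 * t + 1 ≡ t + t + 1
      odd = solve-∀

  -- Since the row product is a character of G, at most half of the rows are balanced.
  balanced-bound : count balanced ≤ 2 * t + 1
  balanced-bound = ℕP.*-cancelˡ-≤ 2 (begin
    2 * count balanced                       ≤⟨ ℕP.*-monoʳ-≤ 2 (count-mono balanced⇒negative) ⟩
    2 * count (isNegative ∘ rowProduct)
      ≤⟨ character-negatives rowProduct (rowProduct-hom {2 * t + 1} n-halves) ⟩
    4 * t + 2                                ≡⟨ n-double ⟩
    2 * (2 * t + 1)                          ∎)
    where open ℕP.≤-Reasoning

  weight : Fin n → ℕ
  weight g = rowWeight (isIdentity g) (isBalanced g) (defect g)

  weight-≥ : ∀ g → ind (nonIdentity g) ≤ weight g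
  weight-≥ g = rowWeight-≥ (isIdentity g) (isBalanced g) (defect g)
    (λ unbal d0 → does-false⇒ (negatives g ℕP.≟ 2 * t + 1) unbal (sym (ℕP.∣m-n∣≡0⇒m≡n d0)))

  total-weight : sumℕ weight ≡ sumℕ maskedDefect + count balanced
  total-weight = sumℕ-+ maskedDefect (ind ∘ balanced)

  -- The common reformulation (P1),(P2) of both sides of the theorem:
  -- every non-identity row has weight exactly one, i.e. is balanced or
  -- off by one, and exactly 2t+1 non-identity rows are balanced.
  record NearlyBalanced : Set where
    field
      unit-weight    : ∀ g → weight g ≡ ind (nonIdentity g)
      balanced-count : count balanced ≡ 2 * t + 1

  open NearlyBalanced

  -- Quasi-orthogonality forces the profile: 4t+1 non-identity rows each of
  -- weight ≥ 1 have total weight 2t + #balanced ≤ 4t+1.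
  quasiOrthogonal⇒profile : QuasiOrthogonal t G ψ → NearlyBalanced
  quasiOrthogonal⇒profile qo = record
    { unit-weight    = λ g → sym (sumℕ-squeeze weight-≥ (sym weight-sum) g)
    ; balanced-count = ℕP.+-cancelˡ-≡ (2 * t) _ _
        (trans (sym sum≡) (trans weight-sum (trans nonIdentity-count (split t))))
    }
    where
      defects : sumℕ maskedDefect ≡ 2 * t
      defects = ℕP.*-cancelˡ-≡ _ (2 * t) 2 (trans (sym RE-defects) (trans qo (double t)))
        where
          double : ∀ t → 4 * t ≡ 2 * (2 * t)
          double = solve-∀
      sum≡ : sumℕ weight ≡ 2 * t + count balanced
      sum≡ = trans total-weight (cong (λ d → d + count balanced) defects)
      split : ∀ t → 4 * t + 1 ≡ 2 * t + (2 * t + 1)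
      split = solve-∀
      weight-sum : sumℕ weight ≡ count nonIdentity
      weight-sum = ℕP.≤-antisym
        (begin
          sumℕ weight                ≡⟨ sum≡ ⟩
          2 * t + count balanced     ≤⟨ ℕP.+-monoʳ-≤ (2 * t) balanced-bound ⟩
          2 * t + (2 * t + 1)        ≡⟨ split t ⟨
          4 * t + 1                  ≡⟨ nonIdentity-count ⟨
          count nonIdentity          ∎)
        (sumℕ-mono weight-≥)
        where open ℕP.≤-Reasoning

  -- Conversely the profile has total weight 4t+1, of which 2t+1 comes from
  -- balanced rows, so the total defect is 2t and RE(M_ψ) = 4t.
  profile⇒quasiOrthogonal : NearlyBalanced → QuasiOrthogonal t G ψ
  profile⇒quasiOrthogonal profile = trans RE-defects (trans (cong (2 *_) defects) (double t))
    where
      double : ∀ t → 2 * (2 * t) ≡ 4 * t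
      double = solve-∀
      split : ∀ t → 4 * t + 1 ≡ 2 * t + (2 * t + 1)
      split = solve-∀
      defects : sumℕ maskedDefect ≡ 2 * t
      defects = ℕP.+-cancelʳ-≡ (2 * t + 1) _ _ (begin
        sumℕ maskedDefect + (2 * t + 1)
          ≡⟨ cong (λ b → sumℕ maskedDefect + b) (balanced-count profile) ⟨
        sumℕ maskedDefect + count balanced
          ≡⟨ total-weight ⟨
        sumℕ weight
          ≡⟨ sumℕ-cong (unit-weight profile) ⟩
        count nonIdentity
          ≡⟨ trans nonIdentity-count (split t) ⟩
        2 * t + (2 * t + 1)
          ∎)
        where open ≡-Reasoning

  interTrans-minus : ∀ k → interTrans (E G ψ) R (Sign.- , k) ≡ negatives k
  interTrans-minus k = trans (interTrans-R Sign.- k) (count-cong (λ h → isPositive-flip (ψ k h)))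

  interTrans-plus : ∀ k → interTrans (E G ψ) R (Sign.+ , k) + negatives k ≡ n
  interTrans-plus k = trans (cong (λ c → c + negatives k) (interTrans-R Sign.+ k))
                            (count-complement (isPositive ∘ ψ k))

  interTrans-balanced : ∀ u k → negatives k ≡ 2 * t + 1 → interTrans (E G ψ) R (u , k) ≡ 2 * t + 1
  interTrans-balanced Sign.- k bal = trans (interTrans-minus k) bal
  interTrans-balanced Sign.+ k bal = ℕP.+-cancelʳ-≡ (negatives k) _ _
    (trans (interTrans-plus k) (trans n-halves (cong (λ c → 2 * t + 1 + c) (sym bal))))

  interTrans-off-by-one : ∀ u k → OffByOne (negatives k) → OffByOne (interTrans (E G ψ) R (u , k))
  interTrans-off-by-one Sign.- k near rewrite interTrans-minus k = near
  interTrans-off-by-one Sign.+ k (inj₁ low) = inj₂ (ℕP.+-cancelʳ-≡ (negatives k) _ _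
    (trans (interTrans-plus k) (trans (step t) (cong (λ c → 2 * t + 2 + c) (sym low)))))
    where
      step : ∀ t → 4 * t + 2 ≡ 2 * t + 2 + 2 * t
      step = solve-∀
  interTrans-off-by-one Sign.+ k (inj₂ high) = inj₁ (ℕP.+-cancelʳ-≡ (negatives k) _ _
    (trans (interTrans-plus k) (trans (step t) (cong (λ c → 2 * t + c) (sym high)))))
    where
      step : ∀ t → 4 * t + 2 ≡ 2 * t + (2 * t + 2)
      step = solve-∀

  -- A balanced row is not the identity row (stated with `balanced g`
  -- unfolded, so that the test g ≟ e can be inspected).
  balanced⇒nonIdentity : ∀ g → not (does (g F.≟ e)) ∧ isBalanced g ≡ true → g ≢ e
  balanced⇒nonIdentity g bal with g F.≟ e
  ... | no g≢e = g≢e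

  length-E-order : length (E-elems n) ≡ 8 * t + 4
  length-E-order = trans (length-E n) (step t)
    where
      step : ∀ t → 4 * t + 2 + (4 * t + 2) ≡ 8 * t + 4
      step = solve-∀

  InCosetOf : (Sign × Fin n → Bool) → Sign × Fin n → Set
  InCosetOf S x = Σ (Sign × Fin n) λ s → (S s ≡ true) × (inCoset (E G ψ) s Z x ≡ true)

  CosetConditions : (Sign × Fin n → Bool) → Set
  CosetConditions S = ∀ x → Z x ≡ false →
      (InCosetOf S x → interTrans (E G ψ) R x ≡ 2 * t + 1)
    × (¬ InCosetOf S x → OffByOne (interTrans (E G ψ) R x))

  -- The profile yields the difference set, with S = {(1,g) : g ≠ 1 balanced}.
  profile⇒QDS : NearlyBalanced → IsRelQDS (E G ψ) t Z R
  profile⇒QDS profile = length-E-order , Z-normal , R-transversal , S , S-in-R , S-count , conditions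
    where
      S : Sign × Fin n → Bool
      S (u , g) = isPositive u ∧ balanced g

      S-in-R : ∀ s → S s ≡ true → (R s ≡ true) × (s ≢ (Sign.+ , e))
      S-in-R (u , g) Ss with ∧-true {isPositive u} Ss
      ... | positive , bal = positive , λ s≡ε → balanced⇒nonIdentity g bal (cong proj₂ s≡ε)

      S-count : length (filterᵇ S (E-elems n)) ≡ 2 * t + 1
      S-count = trans (count-E n S)
        (trans (cong (λ c → count balanced + c) (count-none {n}))
               (trans (ℕP.+-identityʳ _) (balanced-count profile)))

      conditions : CosetConditions S
      conditions (u , k) k≢e = in-S , not-in-S
        where
          in-S : InCosetOf S (u , k) → interTrans (E G ψ) R (u , k) ≡ 2 * t + 1
          in-S ((s₁ , s₂) , Ss , x∈sZ)
            with does-true⇒ (k F.≟ s₂) (trans (sym (inCoset-Z (s₁ , s₂) (u , k))) x∈sZ)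
          ... | refl = interTrans-balanced u k (balanced⇒negatives k (proj₂ (∧-true {isPositive s₁} Ss)))
          not-in-S : ¬ InCosetOf S (u , k) → OffByOne (interTrans (E G ψ) R (u , k))
          not-in-S ∉S with isBalanced k in bal
          ... | true = ⊥-elim (∉S ((Sign.+ , k) , cong₂ _∧_ (cong not k≢e) bal ,
                                   trans (inCoset-Z (Sign.+ , k) (u , k)) (dec-true (k F.≟ k) refl)))
          ... | false = interTrans-off-by-one u k (defect-one⇒off-by-one k
                          (rowWeight-unbalanced k≢e bal (unit-weight profile k)))

  -- The rows seen by a set S satisfying the difference-set conditions: S
  -- consists of the (1,g) with g ≠ 1 balanced, and every other non-identity
  -- row is off by one.
  module DifferenceSetRows
    (S : Sign × Fin n → Bool)
    (S-in-R : ∀ s → S s ≡ true → (R s ≡ true) × (s ≢ (Sign.+ , e)))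
    (conditions : CosetConditions S)
    where

    S⁺ : Fin n → Bool
    S⁺ g = S (Sign.+ , g)

    S⁺-nonIdentity : ∀ g → S⁺ g ≡ true → g ≢ e
    S⁺-nonIdentity g inS g≡e = proj₂ (S-in-R (Sign.+ , g) inS) (cong (Sign.+ ,_) g≡e)

    meets-S : ∀ g → InCosetOf S (Sign.- , g) → S⁺ g ≡ true
    meets-S g ((s₁ , s₂) , Ss , x∈sZ)
      with does-true⇒ (g F.≟ s₂) (trans (sym (inCoset-Z (s₁ , s₂) (Sign.- , g))) x∈sZ)
         | does-true⇒ (s₁ SP.≟ Sign.+) (proj₁ (S-in-R (s₁ , s₂) Ss))
    ... | refl | refl = Ss

    S⁺-balanced : ∀ g → S⁺ g ≡ true → negatives g ≡ 2 * t + 1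
    S⁺-balanced g inS = trans (sym (interTrans-minus g))
      (proj₁ (conditions (Sign.- , g) (dec-false (g F.≟ e) (S⁺-nonIdentity g inS)))
        ((Sign.+ , g) , inS , trans (inCoset-Z (Sign.+ , g) (Sign.- , g)) (dec-true (g F.≟ g) refl)))

    S⁺-off-by-one : ∀ g → isIdentity g ≡ false → S⁺ g ≡ false → OffByOne (negatives g)
    S⁺-off-by-one g g≢e outS rewrite sym (interTrans-minus g) =
      proj₂ (conditions (Sign.- , g) g≢e) (λ hit → true≢false (trans (sym (meets-S g hit)) outS))
      where
        true≢false : true ≢ false
        true≢false ()

    row-shape : ∀ g → isIdentity g ≡ false →
      (isBalanced g ≡ true × defect g ≡ 0) ⊎ (isBalanced g ≡ false × defect g ≡ 1)
    row-shape g g≢e with S⁺ g in inS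
    ... | true = inj₁ (dec-true (negatives g ℕP.≟ 2 * t + 1) (S⁺-balanced g inS) ,
                       balanced⇒defect-zero g (S⁺-balanced g inS))
    ... | false = inj₂ (off-by-one⇒unbalanced g (S⁺-off-by-one g g≢e inS) ,
                        off-by-one⇒defect-one g (S⁺-off-by-one g g≢e inS))

    S⁺≡balanced : ∀ g → balanced g ≡ S⁺ g
    S⁺≡balanced g = bool-ext to from
      where
        to : balanced g ≡ true → S⁺ g ≡ true
        to bal with S⁺ g in inS
        ... | true = refl
        ... | false = ⊥-elim (ℕP.1+n≢0 (trans (sym (off-by-one⇒defect-one g near))
                        (balanced⇒defect-zero g (balanced⇒negatives g bal))))
          where
            near : OffByOne (negatives g)
            near = S⁺-off-by-one g (dec-false (g F.≟ e) (balanced⇒nonIdentity g bal)) inS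
        from : S⁺ g ≡ true → balanced g ≡ true
        from inS = cong₂ _∧_ (cong not (dec-false (g F.≟ e) (S⁺-nonIdentity g inS)))
                             (dec-true (negatives g ℕP.≟ 2 * t + 1) (S⁺-balanced g inS))

    -- S ⊆ R lies in the sheet {+1} × G.
    S-count≡ : length (filterᵇ S (E-elems n)) ≡ count S⁺
    S-count≡ = trans (count-E n S)
      (trans (cong (λ c → count S⁺ + c) (trans (count-cong S⁻-empty) (count-none {n})))
             (ℕP.+-identityʳ (count S⁺)))
      where
        S⁻-empty : ∀ g → S (Sign.- , g) ≡ false
        S⁻-empty g with S (Sign.- , g) in inS
        ... | true with proj₁ (S-in-R (Sign.- , g) inS)
        ...   | ()
        S⁻-empty g | false = refl

  QDS⇒profile : IsRelQDS (E G ψ) t Z R → NearlyBalanced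
  QDS⇒profile (_ , _ , _ , S , S-in-R , S-count , conditions) = record
    { unit-weight    = λ g → rowWeight-unit (isIdentity g) (isBalanced g) (defect g) (row-shape g)
    ; balanced-count = trans (count-cong S⁺≡balanced) (trans (sym S-count≡) S-count)
    }
    where open DifferenceSetRows S S-in-R conditions

proposition4 : (t : ℕ) → t ≥ 1 → (G : FinGroup (4 * t + 2))
    → (ψ : Fin (4 * t + 2) → Fin (4 * t + 2) → Sign) → IsCocycle G ψ
    → QuasiOrthogonal t G ψ ⇔ IsRelQDS (E G ψ) t (Zψ G ψ) (Rψ G ψ)
proposition4 t _ G ψ coc =
  mk⇔ (profile⇒QDS ∘ quasiOrthogonal⇒profile) (profile⇒quasiOrthogonal ∘ QDS⇒profile)
  where open RowProfile t G ψ coc
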